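{- Let $\phi$ be the map on Dyck words defined below. For all integers $n\ge 0$, $m\ge 0$, $k\ge 0$, the map $\phi$ restricts to a bijection from the set of Dyck paths of semilength $n$ with $m$ contacts and $k$ up-steps at odd height onto the set of Dyck paths of semilength $n$ with $m$ contacts and $k$ peaks.
   Context: Paths are lattice paths starting at $(0,0)$ with up-steps $(1,1)$ and down-steps $(1,-1)$; they are identified with words over $\{U,D\}$ ($U$ = up-step, $D$ = down-step). A Dyck word of semilength $n$ is a word with $n$ letters $U$ and $n$ letters $D$ such that no initial segment has more $D$'s than $U$'s; equivalently a Dyck path is such a path ending on $y=0$ with no vertex of negative $y$-coordinate. An up-step from $(i-1,j-1)$ to $(i,j)$ is at height $j$; a down-step from $(i,j)$ to $(i+1,j-1)$ is at height $j$; a step is at odd height if $j$ is odd. A peak is an up-step immediately followed by a down-step. A contact is a down-step at height $1$ or an up-step at height $0$. Definition of $\phi$: $\phi(\epsilon)=\epsilon$ for the empty word $\epsilon$. Every nonempty Dyck word $W$ can be uniquely written as $W = U\big(\prod_{i=1}^s U W_i D\big) D W_{s+1}$ with $s\ge 0$ and each $W_i$ a (possibly empty) Dyck word (here $s$ is the number of down-steps at height $2$ before the first contact); then recursively $\phi(W)=\big(\prod_{i=1}^s U\phi(W_i)\big)\,U D\, D^s\,\phi(W_{s+1})$, where products denote concatenation in order $i=1,\dots,s$. -}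

module Defs where

open import Data.Nat using (ℕ; zero; suc; _+_)
open import Data.Nat.Properties using (_≟_)
open import Data.List using (List; []; _∷_; _++_; length; replicate; concat; map)
open import Data.Maybe using (Maybe; just; nothing)
open import Data.Product using (_×_; _,_)
open import Data.Bool using (Bool; true; false; if_then_else_)
open import Relation.Nullary.Decidable using (⌊_⌋)

data Step : Set where
  U D : Step

Word : Set
Word = List Step

data DyckFrom : ℕ → Word → Set where
  done : DyckFrom 0 []
  up   : ∀ {h w} → DyckFrom (suc h) w → DyckFrom h (U ∷ w)
  down : ∀ {h w} → DyckFrom h w → DyckFrom (suc h) (D ∷ w)

IsDyck : Word → Set
IsDyck w = DyckFrom 0 w

semilength : Word → ℕ
semilength []      = 0
semilength (U ∷ w) = suc (semilength w)
semilength (D ∷ w) = semilength w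

-- Walking from current height h (the y-coordinate before the step).
-- An up-step from height h goes to h+1 and is "at height h+1";
-- a down-step from height h is "at height h".
odd : ℕ → Bool
odd zero          = false
odd (suc zero)    = true
odd (suc (suc n)) = odd n

b2n : Bool → ℕ
b2n true  = 1
b2n false = 0

oddUpsFrom : ℕ → Word → ℕ
oddUpsFrom h []      = 0
oddUpsFrom h (U ∷ w) = b2n (odd (suc h)) + oddUpsFrom (suc h) w
oddUpsFrom h (D ∷ w) = oddUpsFrom (h Data.Nat.∸ 1) w

oddUps : Word → ℕ
oddUps = oddUpsFrom 0

-- contacts: down-steps at height 1 or up-steps at height 0
-- (an up-step from h is at height h+1, which is never 0)
contactsFrom : ℕ → Word → ℕ
contactsFrom h []      = 0
contactsFrom h (U ∷ w) = contactsFrom (suc h) w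
contactsFrom h (D ∷ w) = b2n ⌊ h ≟ 1 ⌋ + contactsFrom (h Data.Nat.∸ 1) w

contacts : Word → ℕ
contacts = contactsFrom 0

peaks : Word → ℕ
peaks []            = 0
peaks (U ∷ D ∷ w)   = suc (peaks (D ∷ w))
peaks (_ ∷ w)       = peaks w

-- Given the word after an opening U, find its matching D:
-- matchAux d w returns (inner , rest) with w = inner ++ D ∷ rest.
matchAux : ℕ → Word → Maybe (Word × Word)
matchAux d [] = nothing
matchAux d (U ∷ w) with matchAux (suc d) w
... | just (a , b) = just (U ∷ a , b)
... | nothing      = nothing
matchAux zero (D ∷ w) = just ([] , w)
matchAux (suc d) (D ∷ w) with matchAux d w
... | just (a , b) = just (D ∷ a , b)
... | nothing      = nothing

-- For W = U A D B with U A D the first prime factor, return (A , B).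
firstPrime : Word → Maybe (Word × Word)
firstPrime (U ∷ w) = matchAux 0 w
firstPrime _       = nothing

-- For A = ∏_{i=1}^s U W_i D, return the list [W_1, …, W_s]  (fuel-bounded).
factors : ℕ → Word → List Word
factors zero    _ = []
factors (suc f) w with firstPrime w
... | just (a , b) = a ∷ factors f b
... | nothing      = []

-- φ with fuel; the fuel (length of the word) is always sufficient
-- since every recursive call is on a strictly shorter word.
φ' : ℕ → Word → Word
φ' zero    _ = []
φ' (suc f) w with firstPrime w
... | nothing = []
... | just (a , b) with factors (length a) a
...   | ws = concat (map (λ wi → U ∷ φ' f wi) ws)
               ++ (U ∷ D ∷ replicate (length ws) D) ++ φ' f b

φ : Word → Word
φ w = φ' (length w) w

module Submission where

-- A Dyck word is the preorder code of a plane forest (U on entering a node, D on leaving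
-- it).  Under this dictionary the semilength is the number of nodes, the contacts are the
-- roots, the up-steps at odd height are the nodes at odd depth and the peaks are the leaves.
-- The recursion defining φ becomes a map Φ on forests acting root by root: a root whose
-- children carry the forests W₁, …, Wₛ is replaced by a root whose children are the trees
-- of Φ W₁ followed by one node whose children are obtained in the same way from W₂, …, Wₛ
-- (a leaf when s = 0).  Every node at odd depth thus contributes exactly one leaf, and Φ
-- has an explicit inverse that regrafts these nested last children.

open import Defs
open import Data.Nat using (ℕ; zero; suc; _+_; _≤_; z≤n; s≤s)
open import Data.Nat.Properties
  using (+-assoc; +-suc; +-identityʳ; m≤m+n; m≤n+m; n≤1+n; ≤-trans; ≤-pred)
open import Data.List using (List; []; _∷_; _++_; length; replicate; concat; map)
open import Data.List.Properties using (∷-injectiveʳ; ++-assoc; length-map)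
open import Data.Maybe using (just)
open import Data.Product using (Σ; _×_; ∃; _,_; proj₁)
open import Data.Bool using (Bool; true; false; not)
open import Relation.Binary.PropositionalEquality
  using (_≡_; refl; sym; trans; cong; cong₂; subst; module ≡-Reasoning)
open ≡-Reasoning

data Tree : Set where
  node : List Tree → Tree

Forest : Set
Forest = List Tree

children : Tree → Forest
children (node ts) = ts

enc : Forest → Word → Word
enc []             w = w
enc (node ts ∷ F) w = U ∷ enc ts (D ∷ enc F w)

⌜_⌝ : Forest → Word
⌜ F ⌝ = enc F []

size : Forest → ℕ
size []             = 0
size (node ts ∷ F) = suc (size ts + size F)

mutual
  leaves : Forest → ℕ
  leaves []      = 0
  leaves (t ∷ F) = leavesᵗ t + leaves F

  leavesᵗ : Tree → ℕ
  leavesᵗ (node [])           = 1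
  leavesᵗ (node ts@(_ ∷ _)) = leaves ts

-- oddNodes p F counts the nodes of F at odd depth, where p says whether the roots have odd depth.
oddNodes : Bool → Forest → ℕ
oddNodes p []             = 0
oddNodes p (node ts ∷ F) = b2n p + (oddNodes (not p) ts + oddNodes p F)

size-++ : ∀ A B → size (A ++ B) ≡ size A + size B
size-++ []             B = refl
size-++ (node ts ∷ A) B = cong suc (begin
  size ts + size (A ++ B)     ≡⟨ cong (size ts +_) (size-++ A B) ⟩
  size ts + (size A + size B) ≡⟨ +-assoc (size ts) (size A) (size B) ⟨
  size ts + size A + size B   ∎)

leaves-++ : ∀ A B → leaves (A ++ B) ≡ leaves A + leaves B
leaves-++ []      B = refl
leaves-++ (t ∷ A) B = trans (cong (leavesᵗ t +_) (leaves-++ A B)) (sym (+-assoc (leavesᵗ t) _ _))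

leavesᵗ-∷ʳ : ∀ A t → leavesᵗ (node (A ++ t ∷ [])) ≡ leaves A + leavesᵗ t
leavesᵗ-∷ʳ []      t = +-identityʳ (leavesᵗ t)
leavesᵗ-∷ʳ (s ∷ A) t =
  trans (leaves-++ (s ∷ A) (t ∷ [])) (cong (leaves (s ∷ A) +_) (+-identityʳ (leavesᵗ t)))

length≤size : ∀ F → length F ≤ size F
length≤size []             = z≤n
length≤size (node ts ∷ F) = s≤s (≤-trans (length≤size F) (m≤n+m (size F) (size ts)))

enc-⌜⌝ : ∀ F w → enc F w ≡ ⌜ F ⌝ ++ w
enc-⌜⌝ []             w = refl
enc-⌜⌝ (node ts ∷ F) w = cong (U ∷_) (begin
  enc ts (D ∷ enc F w)           ≡⟨ enc-⌜⌝ ts _ ⟩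
  ⌜ ts ⌝ ++ D ∷ enc F w          ≡⟨ cong (λ x → ⌜ ts ⌝ ++ D ∷ x) (enc-⌜⌝ F w) ⟩
  ⌜ ts ⌝ ++ (D ∷ ⌜ F ⌝ ++ w)     ≡⟨ ++-assoc ⌜ ts ⌝ (D ∷ ⌜ F ⌝) w ⟨
  (⌜ ts ⌝ ++ D ∷ ⌜ F ⌝) ++ w     ≡⟨ cong (_++ w) (enc-⌜⌝ ts (D ∷ ⌜ F ⌝)) ⟨
  enc ts (D ∷ ⌜ F ⌝) ++ w        ∎)

enc-dyck : ∀ F {h w} → DyckFrom h w → DyckFrom h (enc F w)
enc-dyck []             d = d
enc-dyck (node ts ∷ F) d = up (enc-dyck ts (down (enc-dyck F d)))

-- A path from height h down to 0 reads F₀ D F₁ D … D F_h for forests Fᵢ;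
-- the innermost pending node is closed by the first D.
Stack : ℕ → Set
Stack zero    = Forest
Stack (suc h) = Forest × Stack h

stackWord : (h : ℕ) → Stack h → Word
stackWord zero    F       = ⌜ F ⌝
stackWord (suc h) (F , s) = enc F (D ∷ stackWord h s)

pushTree : (h : ℕ) → Tree → Stack h → Stack h
pushTree zero    t F       = t ∷ F
pushTree (suc h) t (F , s) = t ∷ F , s

stackWord-pushTree : ∀ h ts s →
  stackWord h (pushTree h (node ts) s) ≡ U ∷ enc ts (D ∷ stackWord h s)
stackWord-pushTree zero    ts F       = refl
stackWord-pushTree (suc h) ts (F , s) = refl

parse : ∀ {h w} → DyckFrom h w → Σ (Stack h) λ s → stackWord h s ≡ w
parse done = [] , refl
parse (down d) with parse d
... | s , refl = ([] , s) , refl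
parse {h} (up d) with parse d
... | (ts , s) , refl = pushTree h (node ts) s , stackWord-pushTree h ts s

dyck⇒code : ∀ {w} → IsDyck w → ∃ λ F → ⌜ F ⌝ ≡ w
dyck⇒code = parse

data NotUp : Word → Set where
  empty   : NotUp []
  startsD : ∀ {w} → NotUp (D ∷ w)

enc-injective : ∀ F G {w v} → NotUp w → NotUp v → enc F w ≡ enc G v → F ≡ G × w ≡ v
enc-injective []             []             _  _  eq = refl , eq
enc-injective []             (node _ ∷ _)  empty   _ ()
enc-injective []             (node _ ∷ _)  startsD _ ()
enc-injective (node _ ∷ _)  []             _ empty   ()
enc-injective (node _ ∷ _)  []             _ startsD ()
enc-injective (node ts ∷ F) (node us ∷ G) nw nv eq
  with refl , eq′ ← enc-injective ts us startsD startsD (∷-injectiveʳ eq)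
  with refl , eq″ ← enc-injective F G nw nv (∷-injectiveʳ eq′)
  = refl , eq″

⌜⌝-injective : ∀ {F G} → ⌜ F ⌝ ≡ ⌜ G ⌝ → F ≡ G
⌜⌝-injective {F} {G} eq = proj₁ (enc-injective F G empty empty eq)

semilength-enc : ∀ F w → semilength (enc F w) ≡ size F + semilength w
semilength-enc []             w = refl
semilength-enc (node ts ∷ F) w = cong suc (begin
  semilength (enc ts (D ∷ enc F w))    ≡⟨ semilength-enc ts _ ⟩
  size ts + semilength (enc F w)        ≡⟨ cong (size ts +_) (semilength-enc F w) ⟩
  size ts + (size F + semilength w)     ≡⟨ +-assoc (size ts) (size F) _ ⟨
  size ts + size F + semilength w       ∎)

contactsFrom-suc-enc : ∀ h F w → contactsFrom (suc h) (enc F w) ≡ contactsFrom (suc h) w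
contactsFrom-suc-enc h []             w = refl
contactsFrom-suc-enc h (node ts ∷ F) w =
  trans (contactsFrom-suc-enc (suc h) ts _) (contactsFrom-suc-enc h F w)

contacts-enc : ∀ F w → contacts (enc F w) ≡ length F + contacts w
contacts-enc []             w = refl
contacts-enc (node ts ∷ F) w = trans (contactsFrom-suc-enc 0 ts _) (cong suc (contacts-enc F w))

not-odd-suc : ∀ h → not (odd (suc h)) ≡ odd h
not-odd-suc zero          = refl
not-odd-suc (suc zero)    = refl
not-odd-suc (suc (suc h)) = not-odd-suc h

oddUpsFrom-enc : ∀ h F w → oddUpsFrom h (enc F w) ≡ oddNodes (odd (suc h)) F + oddUpsFrom h w
oddUpsFrom-enc h []             w = refl
oddUpsFrom-enc h (node ts ∷ F) w = begin
  b + oddUpsFrom (suc h) (enc ts (D ∷ enc F w))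
    ≡⟨ cong (b +_) (oddUpsFrom-enc (suc h) ts _) ⟩
  b + (oddNodes (odd h) ts + oddUpsFrom h (enc F w))
    ≡⟨ cong (λ q → b + (oddNodes q ts + oddUpsFrom h (enc F w))) (not-odd-suc h) ⟨
  b + (oddNodes p′ ts + oddUpsFrom h (enc F w))
    ≡⟨ cong (λ x → b + (oddNodes p′ ts + x)) (oddUpsFrom-enc h F w) ⟩
  b + (oddNodes p′ ts + (oddNodes p F + r))
    ≡⟨ cong (b +_) (+-assoc (oddNodes p′ ts) _ r) ⟨
  b + (oddNodes p′ ts + oddNodes p F + r)
    ≡⟨ +-assoc b _ r ⟨
  b + (oddNodes p′ ts + oddNodes p F) + r ∎
  where
  p p′ : Bool
  p  = odd (suc h)
  p′ = not p
  b r : ℕ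
  b  = b2n p
  r  = oddUpsFrom h w

peaks-enc : ∀ F w → peaks (enc F w) ≡ leaves F + peaks w
peaks-enc []                          w = refl
peaks-enc (node [] ∷ F)               w = cong suc (peaks-enc F w)
peaks-enc (node ts@(node _ ∷ _) ∷ F) w = begin
  peaks (enc ts (D ∷ enc F w))   ≡⟨ peaks-enc ts _ ⟩
  leaves ts + peaks (enc F w)    ≡⟨ cong (leaves ts +_) (peaks-enc F w) ⟩
  leaves ts + (leaves F + peaks w) ≡⟨ +-assoc (leaves ts) _ _ ⟨
  leaves ts + leaves F + peaks w ∎

semilength-⌜⌝ : ∀ F → semilength ⌜ F ⌝ ≡ size F
semilength-⌜⌝ F = trans (semilength-enc F []) (+-identityʳ (size F))

contacts-⌜⌝ : ∀ F → contacts ⌜ F ⌝ ≡ length F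
contacts-⌜⌝ F = trans (contacts-enc F []) (+-identityʳ (length F))

oddUps-⌜⌝ : ∀ F → oddUps ⌜ F ⌝ ≡ oddNodes true F
oddUps-⌜⌝ F = trans (oddUpsFrom-enc 0 F []) (+-identityʳ (oddNodes true F))

peaks-⌜⌝ : ∀ F → peaks ⌜ F ⌝ ≡ leaves F
peaks-⌜⌝ F = trans (peaks-enc F []) (+-identityʳ (leaves F))

mutual
  Φ : Forest → Forest
  Φ []             = []
  Φ (node ts ∷ F) = node (Ψ ts) ∷ Φ F

  Ψ : Forest → Forest
  Ψ []             = []
  Ψ (node ts ∷ F) = Φ ts ++ node (Ψ F) ∷ []

graft : Forest → Forest → Forest
graft G []             = node [] ∷ G
graft G (node H ∷ F) = node (node G ∷ H) ∷ F

Ψ⁻¹ : Forest → Forest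
Ψ⁻¹ []             = []
Ψ⁻¹ (node ts ∷ F) = graft (Ψ⁻¹ ts) (Ψ⁻¹ F)

Φ⁻¹ : Forest → Forest
Φ⁻¹ []             = []
Φ⁻¹ (node ts ∷ F) = node (Ψ⁻¹ ts) ∷ Φ⁻¹ F

Ψ-graft : ∀ G F → Ψ (graft G F) ≡ node (Ψ G) ∷ Ψ F
Ψ-graft G []           = refl
Ψ-graft G (node H ∷ F) = refl

Ψ-Ψ⁻¹ : ∀ F → Ψ (Ψ⁻¹ F) ≡ F
Ψ-Ψ⁻¹ []             = refl
Ψ-Ψ⁻¹ (node ts ∷ F) =
  trans (Ψ-graft (Ψ⁻¹ ts) (Ψ⁻¹ F)) (cong₂ (λ G H → node G ∷ H) (Ψ-Ψ⁻¹ ts) (Ψ-Ψ⁻¹ F))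

Φ-Φ⁻¹ : ∀ F → Φ (Φ⁻¹ F) ≡ F
Φ-Φ⁻¹ []             = refl
Φ-Φ⁻¹ (node ts ∷ F) = cong₂ (λ G H → node G ∷ H) (Ψ-Ψ⁻¹ ts) (Φ-Φ⁻¹ F)

Ψ⁻¹-∷ʳ : ∀ A H → Ψ⁻¹ (A ++ node H ∷ []) ≡ node (Φ⁻¹ A) ∷ Ψ⁻¹ H
Ψ⁻¹-∷ʳ []             H = refl
Ψ⁻¹-∷ʳ (node ts ∷ A) H = cong (graft (Ψ⁻¹ ts)) (Ψ⁻¹-∷ʳ A H)

mutual
  Φ⁻¹-Φ : ∀ F → Φ⁻¹ (Φ F) ≡ F
  Φ⁻¹-Φ []             = refl
  Φ⁻¹-Φ (node ts ∷ F) = cong₂ (λ G H → node G ∷ H) (Ψ⁻¹-Ψ ts) (Φ⁻¹-Φ F)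

  Ψ⁻¹-Ψ : ∀ F → Ψ⁻¹ (Ψ F) ≡ F
  Ψ⁻¹-Ψ []             = refl
  Ψ⁻¹-Ψ (node ts ∷ F) =
    trans (Ψ⁻¹-∷ʳ (Φ ts) (Ψ F)) (cong₂ (λ G H → node G ∷ H) (Φ⁻¹-Φ ts) (Ψ⁻¹-Ψ F))

Φ-injective : ∀ {F G} → Φ F ≡ Φ G → F ≡ G
Φ-injective {F} {G} eq = begin
  F           ≡⟨ Φ⁻¹-Φ F ⟨
  Φ⁻¹ (Φ F)   ≡⟨ cong Φ⁻¹ eq ⟩
  Φ⁻¹ (Φ G)   ≡⟨ Φ⁻¹-Φ G ⟩
  G           ∎

length-Φ : ∀ F → length (Φ F) ≡ length F
length-Φ []             = refl
length-Φ (node ts ∷ F) = cong suc (length-Φ F)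

mutual
  size-Φ : ∀ F → size (Φ F) ≡ size F
  size-Φ []             = refl
  size-Φ (node ts ∷ F) = cong suc (cong₂ _+_ (size-Ψ ts) (size-Φ F))

  size-Ψ : ∀ F → size (Ψ F) ≡ size F
  size-Ψ []             = refl
  size-Ψ (node ts ∷ F) = begin
    size (Φ ts ++ node (Ψ F) ∷ [])   ≡⟨ size-++ (Φ ts) _ ⟩
    size (Φ ts) + suc (size (Ψ F) + 0)
      ≡⟨ cong₂ (λ a b → a + suc b) (size-Φ ts) (trans (+-identityʳ _) (size-Ψ F)) ⟩
    size ts + suc (size F)            ≡⟨ +-suc (size ts) (size F) ⟩
    suc (size ts + size F)            ∎

mutual
  leaves-Φ : ∀ F → leaves (Φ F) ≡ oddNodes true F
  leaves-Φ []             = refl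
  leaves-Φ (node ts ∷ F) = cong₂ _+_ (leavesᵗ-Ψ ts) (leaves-Φ F)

  leavesᵗ-Ψ : ∀ F → leavesᵗ (node (Ψ F)) ≡ suc (oddNodes false F)
  leavesᵗ-Ψ []             = refl
  leavesᵗ-Ψ (node ts ∷ F) = begin
    leavesᵗ (node (Φ ts ++ node (Ψ F) ∷ []))   ≡⟨ leavesᵗ-∷ʳ (Φ ts) (node (Ψ F)) ⟩
    leaves (Φ ts) + leavesᵗ (node (Ψ F))      ≡⟨ cong₂ _+_ (leaves-Φ ts) (leavesᵗ-Ψ F) ⟩
    oddNodes true ts + suc (oddNodes false F) ≡⟨ +-suc (oddNodes true ts) _ ⟩
    suc (oddNodes true ts + oddNodes false F) ∎

matchAux-U : ∀ d y {a b} → matchAux (suc d) y ≡ just (a , b) → matchAux d (U ∷ y) ≡ just (U ∷ a , b)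
matchAux-U d y eq with matchAux (suc d) y
matchAux-U d y refl | just _ = refl

matchAux-D : ∀ d y {a b} → matchAux d y ≡ just (a , b) → matchAux (suc d) (D ∷ y) ≡ just (D ∷ a , b)
matchAux-D d y eq with matchAux d y
matchAux-D d y refl | just _ = refl

matchAux-enc : ∀ G d w {a b} → matchAux d w ≡ just (a , b) → matchAux d (enc G w) ≡ just (enc G a , b)
matchAux-enc []             d w eq = eq
matchAux-enc (node ts ∷ G) d w eq =
  matchAux-U d (enc ts (D ∷ enc G w))
    (matchAux-enc ts (suc d) (D ∷ enc G w) (matchAux-D d (enc G w) (matchAux-enc G d w eq)))

firstPrime-enc : ∀ ts F w → firstPrime (enc (node ts ∷ F) w) ≡ just (⌜ ts ⌝ , enc F w)
firstPrime-enc ts F w = matchAux-enc ts 0 (D ∷ enc F w) refl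

factors-unfold : ∀ f w {a b} → firstPrime w ≡ just (a , b) → factors (suc f) w ≡ a ∷ factors f b
factors-unfold f w eq with firstPrime w
factors-unfold f w refl | just _ = refl

φ-step : (Word → Word) → List Word → Word → Word
φ-step g ws b = concat (map (λ wi → U ∷ g wi) ws) ++ (U ∷ D ∷ replicate (length ws) D) ++ b

φ'-unfold : ∀ f w {a b} → firstPrime w ≡ just (a , b) →
  φ' (suc f) w ≡ φ-step (φ' f) (factors (length a) a) (φ' f b)
φ'-unfold f w eq with firstPrime w
φ'-unfold f w refl | just _ = refl

semilength≤length : ∀ w → semilength w ≤ length w
semilength≤length []      = z≤n
semilength≤length (U ∷ w) = s≤s (semilength≤length w)
semilength≤length (D ∷ w) = ≤-trans (semilength≤length w) (n≤1+n _)

size≤length-⌜⌝ : ∀ F → size F ≤ length ⌜ F ⌝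
size≤length-⌜⌝ F = subst (_≤ length ⌜ F ⌝) (semilength-⌜⌝ F) (semilength≤length ⌜ F ⌝)

factors-⌜⌝ : ∀ f ts → length ts ≤ f → factors f ⌜ ts ⌝ ≡ map (λ t → ⌜ children t ⌝) ts
factors-⌜⌝ zero    []             _ = refl
factors-⌜⌝ zero    (_ ∷ _)       ()
factors-⌜⌝ (suc f) []             _ = refl
factors-⌜⌝ (suc f) (node ts ∷ F) p =
  trans (factors-unfold f ⌜ node ts ∷ F ⌝ (firstPrime-enc ts F []))
        (cong (⌜ ts ⌝ ∷_) (factors-⌜⌝ f F (≤-pred p)))

replicate-∷ʳ : ∀ n {A : Set} (x : A) xs → replicate n x ++ x ∷ xs ≡ x ∷ replicate n x ++ xs
replicate-∷ʳ zero    x xs = refl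
replicate-∷ʳ (suc n) x xs = cong (x ∷_) (replicate-∷ʳ n x xs)

enc-++ : ∀ A B w → enc (A ++ B) w ≡ enc A (enc B w)
enc-++ []             B w = refl
enc-++ (node ts ∷ A) B w = cong (λ x → U ∷ enc ts (D ∷ x)) (enc-++ A B w)

enc-Ψ : ∀ ts y → U ∷ enc (Ψ ts) (D ∷ y) ≡
  concat (map (λ t → U ∷ ⌜ Φ (children t) ⌝) ts) ++ (U ∷ D ∷ replicate (length ts) D) ++ y
enc-Ψ []             y = refl
enc-Ψ (node ts ∷ F) y = cong (U ∷_) (begin
  enc (Φ ts ++ node (Ψ F) ∷ []) (D ∷ y)    ≡⟨ enc-++ (Φ ts) _ _ ⟩
  enc (Φ ts) (U ∷ enc (Ψ F) (D ∷ D ∷ y))   ≡⟨ enc-⌜⌝ (Φ ts) _ ⟩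
  ⌜ Φ ts ⌝ ++ U ∷ enc (Ψ F) (D ∷ D ∷ y)    ≡⟨ cong (⌜ Φ ts ⌝ ++_) (enc-Ψ F (D ∷ y)) ⟩
  ⌜ Φ ts ⌝ ++ (bs ++ U ∷ D ∷ replicate n D ++ D ∷ y)
    ≡⟨ cong (λ z → ⌜ Φ ts ⌝ ++ (bs ++ U ∷ D ∷ z)) (replicate-∷ʳ n D y) ⟩
  ⌜ Φ ts ⌝ ++ (bs ++ U ∷ D ∷ D ∷ replicate n D ++ y)
    ≡⟨ ++-assoc ⌜ Φ ts ⌝ bs _ ⟨
  (⌜ Φ ts ⌝ ++ bs) ++ U ∷ D ∷ D ∷ replicate n D ++ y ∎)
  where
  bs : Word
  bs = concat (map (λ t → U ∷ ⌜ Φ (children t) ⌝) F)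
  n : ℕ
  n = length F

φ'-⌜⌝ : ∀ f F → size F ≤ f → φ' f ⌜ F ⌝ ≡ ⌜ Φ F ⌝
φ'-⌜⌝ zero    []             _ = refl
φ'-⌜⌝ zero    (node _ ∷ _)  ()
φ'-⌜⌝ (suc f) []             _ = refl
φ'-⌜⌝ (suc f) (node ts ∷ F) p = begin
  φ' (suc f) ⌜ node ts ∷ F ⌝
    ≡⟨ φ'-unfold f ⌜ node ts ∷ F ⌝ (firstPrime-enc ts F []) ⟩
  φ-step (φ' f) (factors (length ⌜ ts ⌝) ⌜ ts ⌝) (φ' f ⌜ F ⌝)
    ≡⟨ cong (λ ws → φ-step (φ' f) ws (φ' f ⌜ F ⌝))
         (factors-⌜⌝ _ ts (≤-trans (length≤size ts) (size≤length-⌜⌝ ts))) ⟩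
  φ-step (φ' f) codes (φ' f ⌜ F ⌝)
    ≡⟨ cong₂ (λ n z → concat (map (λ wi → U ∷ φ' f wi) codes) ++ (U ∷ D ∷ replicate n D) ++ z)
         (length-map (λ t → ⌜ children t ⌝) ts)
         (φ'-⌜⌝ f F (≤-trans (m≤n+m (size F) (size ts)) (≤-pred p))) ⟩
  concat (map (λ wi → U ∷ φ' f wi) codes) ++ (U ∷ D ∷ replicate (length ts) D) ++ ⌜ Φ F ⌝
    ≡⟨ cong (_++ (U ∷ D ∷ replicate (length ts) D) ++ ⌜ Φ F ⌝)
         (blocks ts (≤-trans (m≤m+n (size ts) (size F)) (≤-pred p))) ⟩
  concat (map (λ t → U ∷ ⌜ Φ (children t) ⌝) ts) ++ (U ∷ D ∷ replicate (length ts) D) ++ ⌜ Φ F ⌝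
    ≡⟨ enc-Ψ ts ⌜ Φ F ⌝ ⟨
  ⌜ Φ (node ts ∷ F) ⌝ ∎
  where
  codes : List Word
  codes = map (λ t → ⌜ children t ⌝) ts

  blocks : ∀ us → size us ≤ f →
    concat (map (λ wi → U ∷ φ' f wi) (map (λ t → ⌜ children t ⌝) us)) ≡
    concat (map (λ t → U ∷ ⌜ Φ (children t) ⌝) us)
  blocks []             _ = refl
  blocks (node vs ∷ us) q = cong₂ (λ x y → (U ∷ x) ++ y)
    (φ'-⌜⌝ f vs (≤-trans (m≤m+n (size vs) (size us)) (≤-trans (n≤1+n _) q)))
    (blocks us (≤-trans (m≤n+m (size us) (size vs)) (≤-trans (n≤1+n _) q)))

φ-⌜⌝ : ∀ F → φ ⌜ F ⌝ ≡ ⌜ Φ F ⌝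
φ-⌜⌝ F = φ'-⌜⌝ (length ⌜ F ⌝) F (size≤length-⌜⌝ F)

dyck-elim : ∀ {P : Word → Set} → (∀ F → P ⌜ F ⌝) → ∀ {w} → IsDyck w → P w
dyck-elim p d with F , refl ← dyck⇒code d = p F

φ-dyck : ∀ {w} → IsDyck w → IsDyck (φ w)
φ-dyck = dyck-elim λ F → subst IsDyck (sym (φ-⌜⌝ F)) (enc-dyck (Φ F) done)

semilength-φ : ∀ {w} → IsDyck w → semilength (φ w) ≡ semilength w
semilength-φ = dyck-elim λ F → begin
  semilength (φ ⌜ F ⌝)   ≡⟨ cong semilength (φ-⌜⌝ F) ⟩
  semilength ⌜ Φ F ⌝     ≡⟨ semilength-⌜⌝ (Φ F) ⟩
  size (Φ F)             ≡⟨ size-Φ F ⟩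
  size F                 ≡⟨ semilength-⌜⌝ F ⟨
  semilength ⌜ F ⌝       ∎

contacts-φ : ∀ {w} → IsDyck w → contacts (φ w) ≡ contacts w
contacts-φ = dyck-elim λ F → begin
  contacts (φ ⌜ F ⌝)   ≡⟨ cong contacts (φ-⌜⌝ F) ⟩
  contacts ⌜ Φ F ⌝     ≡⟨ contacts-⌜⌝ (Φ F) ⟩
  length (Φ F)         ≡⟨ length-Φ F ⟩
  length F             ≡⟨ contacts-⌜⌝ F ⟨
  contacts ⌜ F ⌝       ∎

peaks-φ : ∀ {w} → IsDyck w → peaks (φ w) ≡ oddUps w
peaks-φ = dyck-elim λ F → begin
  peaks (φ ⌜ F ⌝)   ≡⟨ cong peaks (φ-⌜⌝ F) ⟩
  peaks ⌜ Φ F ⌝     ≡⟨ peaks-⌜⌝ (Φ F) ⟩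
  leaves (Φ F)      ≡⟨ leaves-Φ F ⟩
  oddNodes true F   ≡⟨ oddUps-⌜⌝ F ⟨
  oddUps ⌜ F ⌝      ∎

φ-injective : ∀ {w₁ w₂} → IsDyck w₁ → IsDyck w₂ → φ w₁ ≡ φ w₂ → w₁ ≡ w₂
φ-injective d₁ d₂ eq with F₁ , refl ← dyck⇒code d₁ | F₂ , refl ← dyck⇒code d₂ =
  cong ⌜_⌝ (Φ-injective (⌜⌝-injective (trans (sym (φ-⌜⌝ F₁)) (trans eq (φ-⌜⌝ F₂)))))

φ-surjective : ∀ {v} → IsDyck v → ∃ λ w → IsDyck w × φ w ≡ v
φ-surjective = dyck-elim λ G →
  ⌜ Φ⁻¹ G ⌝ , enc-dyck (Φ⁻¹ G) done , trans (φ-⌜⌝ (Φ⁻¹ G)) (cong ⌜_⌝ (Φ-Φ⁻¹ G))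

φ-preimage : ∀ {v} → IsDyck v →
  Σ Word λ w → IsDyck w × semilength w ≡ semilength v × contacts w ≡ contacts v × oddUps w ≡ peaks v × φ w ≡ v
φ-preimage d with w , dw , refl ← φ-surjective d =
  w , dw , sym (semilength-φ dw) , sym (contacts-φ dw) , sym (peaks-φ dw) , refl

theorem1 : (n m k : ℕ) →
    ((w : Word) → IsDyck w → semilength w ≡ n → contacts w ≡ m → oddUps w ≡ k →
       IsDyck (φ w) × semilength (φ w) ≡ n × contacts (φ w) ≡ m × peaks (φ w) ≡ k)
    × ((w₁ w₂ : Word) →
         IsDyck w₁ → semilength w₁ ≡ n → contacts w₁ ≡ m → oddUps w₁ ≡ k →
         IsDyck w₂ → semilength w₂ ≡ n → contacts w₂ ≡ m → oddUps w₂ ≡ k →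
         φ w₁ ≡ φ w₂ → w₁ ≡ w₂)
    × ((v : Word) → IsDyck v → semilength v ≡ n → contacts v ≡ m → peaks v ≡ k →
         Σ Word (λ w → IsDyck w × semilength w ≡ n × contacts w ≡ m × oddUps w ≡ k × φ w ≡ v))
theorem1 n m k =
  (λ w d sl ct ou →
    φ-dyck d , trans (semilength-φ d) sl , trans (contacts-φ d) ct , trans (peaks-φ d) ou) ,
  (λ w₁ w₂ d₁ _ _ _ d₂ _ _ _ → φ-injective d₁ d₂) ,
  (λ v d sl ct pk →
    let (w , dw , sl′ , ct′ , ou′ , φw≡v) = φ-preimage d
    in  w , dw , trans sl′ sl , trans ct′ ct , trans ou′ pk , φw≡v)
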